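{- Let $X'\subseteq X$ and let $P=v_0,\dots,v_\ell$ be a rainbow path in $D_{X'}$. Then $\sigma_P$ is an $X'$-switching from $v_0$ to $v_\ell$ of length $\ell$.
   Context: Setting: $G$ is a bipartite graph with bipartition classes $X,Y$ which is the union of $n+1$ edge-disjoint matchings (called colours). $M$ is a rainbow matching (distinct colours) of size $n$ and $c^*$ the colour missing from $M$. For an edge $e$, $(e)_X=e\cap X$, $(e)_Y=e\cap Y$. For a colour $v\neq c^*$, $(v)_M$ is the colour-$v$ edge of $M$, $(v)_X=(v)_M\cap X$, $(v)_Y=(v)_M\cap Y$. The digraph $D_{X'}$: vertices are the colours of $G$; colour $v\neq c^*$ is labelled $(v)_X$ and $c^*$ is labelled $*$; for colours $u,v$ ($v\ne c^*$), $uv$ is an edge labelled $x$ whenever $x\in X'$ and $G$ has a colour-$u$ edge from $x$ to $(v)_Y$. A path is rainbow if all its vertices and edges have pairwise distinct labels. For a path $P=v_0,\dots,v_\ell$ in $D_{X'}$, let $e_i$ ($0\le i\le\ell-1$) be the colour-$v_i$ edge of $G$ corresponding to the edge $v_iv_{i+1}$, and $\sigma_P=(e_0,(v_1)_M,e_1,(v_2)_M,\dots,e_{\ell-1},(v_\ell)_M)$. An $X'$-switching is a sequence of edges $\sigma=(e_0,m_1,e_1,\dots,e_{\ell-1},m_\ell)$ such that (i) each $m_i\in M$ and each $e_i\notin M$; (ii) $m_i$ and $e_i$ have the same colour $c_i$ ($c_0$ the colour of $e_0$, $c_\ell$ that of $m_\ell$); (iii) $e_{i-1}\cap m_i=(m_i)_Y$;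 (iv) for $i\ne j$, $e_i\cap e_j=\emptyset$, $e_{i-1}\cap m_j=\emptyset$, $c_i\ne c_j$; (v) $(e_i)_X\in X'$. It is a switching of length $\ell$ from $c_0$ to $c_\ell$. -}

module Defs where

open import Data.Nat using (ℕ; suc)
open import Data.Fin using (Fin; zero; suc; inject₁; _≟_)
open import Data.Product using (Σ; ∃; _×_; _,_; proj₁; proj₂)
open import Data.Maybe using (Maybe; just; nothing)
open import Relation.Nullary using (¬_; yes; no)
open import Relation.Binary.PropositionalEquality using (_≡_; _≢_)

-- An edge of a bipartite graph with classes X, Y is determined by its
-- X-endpoint and its Y-endpoint:  (e)_X = proj₁ e,  (e)_Y = proj₂ e.
BEdge : Set → Set → Set
BEdge X Y = X × Y

-- The standing setting.  Colours are Fin (suc n) (n+1 colours).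
-- E x y c : G has an edge xy of colour c.
record Setting (X Y : Set) (n : ℕ) : Set₁ where
  field
    E : X → Y → Fin (suc n) → Set
    matchingX : ∀ {x y y′ c} → E x y c → E x y′ c → y ≡ y′
    matchingY : ∀ {x x′ y c} → E x y c → E x′ y c → x ≡ x′
    edgeDisjoint : ∀ {x y c d} → E x y c → E x y d → c ≡ d
    cstar : Fin (suc n)
    -- the rainbow matching M of size n: for each colour v ≠ c*,
    -- (v)_M = (mX v , mY v) is an edge of colour v.  (Values at c* are
    -- irrelevant junk and never used.)
    mX : Fin (suc n) → X
    mY : Fin (suc n) → Y
    M-edge : ∀ v → v ≢ cstar → E (mX v) (mY v) v
    M-matchingX : ∀ v w → v ≢ cstar → w ≢ cstar → v ≢ w → mX v ≢ mX w
    M-matchingY : ∀ v w → v ≢ cstar → w ≢ cstar → v ≢ w → mY v ≢ mY w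

module _ {X Y : Set} {n : ℕ} (S : Setting X Y n) where
  open Setting S

  Colour : Set
  Colour = Fin (suc n)

  Medge : Colour → BEdge X Y
  Medge v = mX v , mY v

  InM : BEdge X Y → Set
  InM e = Σ Colour λ v → v ≢ cstar × e ≡ Medge v

  HasColour : BEdge X Y → Colour → Set
  HasColour e c = E (proj₁ e) (proj₂ e) c

  -- e ∩ f = ∅ (as vertex sets; X and Y are disjoint)
  Disjoint : BEdge X Y → BEdge X Y → Set
  Disjoint e f = proj₁ e ≢ proj₁ f × proj₂ e ≢ proj₂ f

  -- e ∩ m = {(m)_Y}
  MeetsInY : BEdge X Y → BEdge X Y → Set
  MeetsInY e m = proj₂ e ≡ proj₂ m × proj₁ e ≢ proj₁ m

  -- Vertex labels of D_{X'}: just (v)_X for v ≠ c*, and nothing (= *) for c*.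
  vlabel : Colour → Maybe X
  vlabel v with v ≟ cstar
  ... | yes _ = nothing
  ... | no  _ = just (mX v)

  -- A path P = v_0,…,v_ℓ in D_{X'}: vs i = v_i, xs i = label of edge v_i v_{i+1}.
  -- Edge v_i v_{i+1} labelled x exists iff x ∈ X', v_{i+1} ≠ c* and G has a
  -- colour-v_i edge from x to (v_{i+1})_Y.
  record Path (X′ : X → Set) (ℓ : ℕ) : Set where
    field
      vs : Fin (suc ℓ) → Colour
      xs : Fin ℓ → X
      distinct : ∀ i j → vs i ≡ vs j → i ≡ j
      inX′ : ∀ i → X′ (xs i)
      notStar : ∀ i → vs (suc i) ≢ cstar
      isEdge : ∀ i → E (xs i) (mY (vs (suc i))) (vs (inject₁ i))

  Rainbow : {X′ : X → Set} {ℓ : ℕ} → Path X′ ℓ → Set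
  Rainbow {ℓ = ℓ} P =
    (∀ i j → i ≢ j → vlabel (vs i) ≢ vlabel (vs j)) ×
    (∀ i j → i ≢ j → xs i ≢ xs j) ×
    (∀ i j → vlabel (vs i) ≢ just (xs j))
    where open Path P

  -- σ_P = (e_0, (v_1)_M, e_1, …, e_{ℓ-1}, (v_ℓ)_M):
  -- σe i = e_i,  σm i = (v_{i+1})_M   (i : Fin ℓ)
  σe : {X′ : X → Set} {ℓ : ℕ} → Path X′ ℓ → Fin ℓ → BEdge X Y
  σe P i = Path.xs P i , mY (Path.vs P (suc i))

  σm : {X′ : X → Set} {ℓ : ℕ} → Path X′ ℓ → Fin ℓ → BEdge X Y
  σm P i = Medge (Path.vs P (suc i))

  -- An X'-switching σ = (e_0, m_1, e_1, …, e_{ℓ-1}, m_ℓ) of length ℓ from c₀ to c_ℓ,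
  -- given by es i = e_i and ms i = m_{i+1} (i : Fin ℓ), with colours
  -- cs k = c_k (k : Fin (suc ℓ)).
  record IsSwitching (X′ : X → Set) (ℓ : ℕ) (es ms : Fin ℓ → BEdge X Y)
                     (from to : Colour) : Set where
    field
      cs : Fin (suc ℓ) → Colour
      m∈M : ∀ i → InM (ms i)
      e∉M : ∀ i → ¬ InM (es i)
      colE : ∀ i → HasColour (es i) (cs (inject₁ i))
      colM : ∀ i → HasColour (ms i) (cs (suc i))
      meet : ∀ i → MeetsInY (es i) (ms i)
      eDisj : ∀ i j → i ≢ j → Disjoint (es i) (es j)
      emDisj : ∀ i j → i ≢ j → Disjoint (es i) (ms j)
      cDist : ∀ i j → i ≢ j → cs i ≢ cs j
      eX′ : ∀ i → X′ (proj₁ (es i))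
      start : cs zero ≡ from
      end : cs (Data.Fin.fromℕ ℓ) ≡ to

-- The colours of the switching are the path vertices c_k = v_k.  Most
-- clauses of the definition hold by construction of D_{X′}: e_i is a
-- colour-v_i edge from x_i ∈ X′ to (v_{i+1})_Y, and m_{i+1} = (v_{i+1})_M.
-- The remaining clauses are disjointness statements, which all reduce to
-- two facts about a rainbow path:
--   * an edge label x_i is never the X-end of an M-edge (v_{j+1})_X, since
--     vertex labels and edge labels of a rainbow path are distinct;
--   * distinct path vertices v_{i+1}, v_{j+1} ≠ c* have distinct M-edges,
--     hence distinct Y-ends, since M is a matching.
-- From these, e_i ∉ M follows: an M-edge through (v_{i+1})_Y must be
-- (v_{i+1})_M itself, whose X-end is not x_i.
module Submission where

open import Defs
open import Data.Nat using (ℕ; suc)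
open import Data.Fin using (Fin; zero; fromℕ; suc; _≟_)
open import Data.Fin.Properties using (suc-injective)
open import Data.Maybe using (just)
open import Data.Product using (_,_; proj₁; proj₂)
open import Relation.Nullary using (¬_; yes; no)
open import Relation.Binary.PropositionalEquality using (_≡_; _≢_; refl; sym; trans; cong)
open import Data.Empty using (⊥-elim)

vlabel-notStar : {X Y : Set} {n : ℕ} (S : Setting X Y n) (v : Fin (suc n)) →
  v ≢ Setting.cstar S → vlabel S v ≡ just (Setting.mX S v)
vlabel-notStar S v v≢c* with v ≟ Setting.cstar S
... | yes v≡c* = ⊥-elim (v≢c* v≡c*)
... | no _ = refl

module RainbowPath {X Y : Set} {n : ℕ} (S : Setting X Y n) {X′ : X → Set} {ℓ : ℕ}
                   (P : Path S X′ ℓ) (rainbow : Rainbow S P) where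
  open Setting S
  open Path P

  -- An edge label x_i is never the X-end (v_{j+1})_X of an M-edge on P,
  -- because (v_{j+1})_X is the vertex label of v_{j+1}.
  label≢Mx : ∀ i j → xs i ≢ mX (vs (suc j))
  label≢Mx i j xᵢ≡ = proj₂ (proj₂ rainbow) (suc j) i
    (trans (vlabel-notStar S (vs (suc j)) (notStar j)) (cong just (sym xᵢ≡)))

  My-distinct : ∀ i j → i ≢ j → mY (vs (suc i)) ≢ mY (vs (suc j))
  My-distinct i j i≢j = M-matchingY _ _ (notStar i) (notStar j)
    (λ vᵢ≡vⱼ → i≢j (suc-injective (distinct (suc i) (suc j) vᵢ≡vⱼ)))

  e∉M : ∀ i → ¬ InM S (σe S P i)
  e∉M i (w , w≢c* , eᵢ≡) with w ≟ vs (suc i)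
  ... | yes refl = label≢Mx i i (cong proj₁ eᵢ≡)
  ... | no w≢v = M-matchingY _ _ (notStar i) w≢c* (λ v≡w → w≢v (sym v≡w)) (cong proj₂ eᵢ≡)

lemma3p6 : {X Y : Set} {n : ℕ} (S : Setting X Y n) (X′ : X → Set) (ℓ : ℕ)
    (P : Path S X′ ℓ) → Rainbow S P →
    IsSwitching S X′ ℓ (σe S P) (σm S P) (Path.vs P zero) (Path.vs P (fromℕ ℓ))
lemma3p6 S X′ ℓ P rainbow = record
  { cs = vs
  ; m∈M = λ i → vs (suc i) , notStar i , refl
  ; e∉M = e∉M
  ; colE = isEdge
  ; colM = λ i → M-edge (vs (suc i)) (notStar i)
  ; meet = λ i → refl , label≢Mx i i
  ; eDisj = λ i j i≢j → proj₁ (proj₂ rainbow) i j i≢j , My-distinct i j i≢j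
  ; emDisj = λ i j i≢j → label≢Mx i j , My-distinct i j i≢j
  ; cDist = λ i j i≢j vᵢ≡vⱼ → i≢j (distinct i j vᵢ≡vⱼ)
  ; eX′ = inX′
  ; start = refl
  ; end = refl
  }
  where
  open Setting S
  open Path P
  open RainbowPath S P rainbow
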